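{- For every $j>0$, deleting all leaves from the tree $T_j$ yields a tree isomorphic (as an ordered rooted tree) to $T_{j-1}$.
   Context: Fix nonnegative integers $\lambda_1,\lambda_2,\dots$ and an integer $k\ge1$ (the order) such that $\lambda_1\ge1$, $\lambda_k\ge1$, $\lambda_i=0$ for all $i>k$, and $\lambda_1\ge2$ if $k=1$. For $j\ge0$ let $\Lambda_j=\sum_{i=1}^j\lambda_i$ (so $\Lambda_0=0$). All trees are rooted ordered trees (children ordered left to right). Define finite trees $T_j$: $T_0$ is a single node. For $j\ge1$, $T_j$ has levels $0,\dots,j$; it contains a chain of "special" nodes $s_j,s_{j-1},\dots,s_0$, where $s_i$ is on level $i$, $s_j$ is the root, and $s_{i-1}$ is the leftmost child of $s_i$; for $1\le i\le j$ the node $s_i$ has exactly $\Lambda_{j-i+1}$ children, namely $s_{i-1}$ followed (to its right) by $\Lambda_{j-i+1}-1$ children, each the root of a copy of $T_{i-1}$. -}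

module Defs where

open import Data.Nat using (ℕ; zero; suc; _+_; _∸_)
open import Data.List using (List; []; _∷_; replicate)

-- Rooted ordered trees: a node with an ordered (left-to-right) list of children.
-- Two such trees are isomorphic as ordered rooted trees iff they are equal as
-- values of this type.
data Tree : Set where
  node : List Tree → Tree

leaf : Tree
leaf = node []

-- Λ lam j = lam 1 + ... + lam j   (lam 0 is ignored; the sequence is indexed from 1)
Λ : (ℕ → ℕ) → ℕ → ℕ
Λ lam zero = 0
Λ lam (suc j) = Λ lam j + lam (suc j)

mutual
  T : (ℕ → ℕ) → ℕ → Tree
  T lam zero = leaf
  T lam (suc j) = S lam (suc j) (suc j)

  -- S lam j i : the subtree of T_j rooted at the special node s_i (i ≤ j).
  -- s_0 is a leaf; s_i (i ≥ 1) has children s_{i-1} followed by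
  -- Λ_{j-i+1} - 1 copies of T_{i-1}.
  S : (ℕ → ℕ) → ℕ → ℕ → Tree
  S lam j zero = leaf
  S lam j (suc i) = node (S lam j i ∷ replicate (Λ lam (j ∸ i) ∸ 1) (T lam i))

mutual
  deleteLeaves : Tree → Tree
  deleteLeaves (node ts) = node (deleteLeavesList ts)

  deleteLeavesList : List Tree → List Tree
  deleteLeavesList [] = []
  deleteLeavesList (node [] ∷ ts) = deleteLeavesList ts
  deleteLeavesList (node (c ∷ cs) ∷ ts) =
    deleteLeaves (node (c ∷ cs)) ∷ deleteLeavesList ts

-- Deleting leaves removes level 0, i.e. s₀ and the copies of T₀ hanging off s₁.
-- Every other node survives with all its children, and since
-- (j + 1) - (i + 1) = j - i the special node s_{i+1} of T_{j+1} has exactly as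
-- many children as s_i of T_j. Hence the pruned spine of T_{j+1} is the spine
-- of T_j and, by induction on j, the pruned copies of T_{i+1} are copies of T_i.
module Submission where

open import Defs
open import Data.Nat using (ℕ; zero; suc; _≤_; _<_; _∸_)
open import Data.List using (List; []; _∷_; replicate)
open import Relation.Binary.PropositionalEquality using (_≡_; refl; cong; cong₂; trans)

deleteLeavesList-replicate-leaf : ∀ m → deleteLeavesList (replicate m leaf) ≡ []
deleteLeavesList-replicate-leaf zero    = refl
deleteLeavesList-replicate-leaf (suc m) = deleteLeavesList-replicate-leaf m

deleteLeavesList-replicate-node : ∀ m {c} {cs} →
  deleteLeavesList (replicate m (node (c ∷ cs)))
    ≡ replicate m (deleteLeaves (node (c ∷ cs)))
deleteLeavesList-replicate-node zero    = refl
deleteLeavesList-replicate-node (suc m) {c} {cs} =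
  cong (deleteLeaves (node (c ∷ cs)) ∷_) (deleteLeavesList-replicate-node m)

module _ (lam : ℕ → ℕ) where

  mutual
    deleteLeaves-S : ∀ j i → deleteLeaves (S lam (suc j) (suc i)) ≡ S lam j i
    deleteLeaves-S j zero    =
      cong node (deleteLeavesList-replicate-leaf (Λ lam (suc j) ∸ 1))
    deleteLeaves-S j (suc i) =
      cong node (cong₂ _∷_ (deleteLeaves-S j i) copies)
      where
      copies : deleteLeavesList (replicate (Λ lam (j ∸ i) ∸ 1) (T lam (suc i)))
             ≡ replicate (Λ lam (j ∸ i) ∸ 1) (T lam i)
      copies = trans (deleteLeavesList-replicate-node (Λ lam (j ∸ i) ∸ 1))
                     (cong (replicate _) (deleteLeaves-T i))

    deleteLeaves-T : ∀ j → deleteLeaves (T lam (suc j)) ≡ T lam j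
    deleteLeaves-T zero    = deleteLeaves-S zero zero
    deleteLeaves-T (suc j) = deleteLeaves-S (suc j) (suc j)

proposition2p5 : (lam : ℕ → ℕ) (k : ℕ) → 1 ≤ k → 1 ≤ lam 1 → 1 ≤ lam k →
    (∀ i → k < i → lam i ≡ 0) → (k ≡ 1 → 2 ≤ lam 1) →
    ∀ j → 0 < j → deleteLeaves (T lam j) ≡ T lam (j ∸ 1)
proposition2p5 lam _ _ _ _ _ _ (suc j) _ = deleteLeaves-T lam j
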